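{- Let $n\ge 0$ and $\alpha\ge 1$ be integers, $N=2^{n+1}$, $c=2^\alpha+1$, and consider the $c$-DAG over the uniform dataset $\{0,1,\dots,N-1\}$ in the domain $[0,N)$. Let $Q=[x,x+s)\subseteq[0,N)$ be a range query of length $s$ with $1\le s\le N$, and let $\kappa=\lfloor\log_2(N/s)\rfloor$, so that $2^{n-\kappa}<s\le 2^{n-\kappa+1}$. Then SRC-search on the $c$-DAG returns a node at level $\kappa$ if $Q$ is fully contained in a level $\kappa$ node, and otherwise returns a level $\kappa-1$ node; in particular $\mathrm{level}_{c\text{ -DAG}}(Q)\in\{\kappa-1,\kappa\}$. More precisely, it returns a level $\kappa$ node exactly when \[ x\in\bigcup_{m=0}^{(c-1)2^{\kappa}-(c-1)}\left[m\cdot\frac{2^{n-\kappa+1}}{c-1},\ (m+c-1)\cdot\frac{2^{n-\kappa+1}}{c-1}-s\right] \] (each interval in this union is called a level $\kappa$ containment interval), and if $Q$ is not fully contained in any level $\kappa$ node, it returns a level $\kappa-1$ node fully covering $Q$, which happens for \[ x\in\bigcup_{m=0}^{(c-1)2^{\kappa}-c}\left((m+c-1)\cdot\frac{2^{n-\kappa+1}}{c-1}-s,\ (m+1)\cdot\frac{2^{n-\kappa+1}}{c-1}\right). \]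
   Context: Levels are depths, with the root at level $0$. For the uniform dataset $\{0,\dots,N-1\}$, $N=2^{n+1}$, the $c$-DAG ($c=2^\alpha+1$) has root with canonical interval $[0,N)$; each node with interval $[a,a+L)$ has $c$ children with intervals $[a,a+L/2)$, $[a+L/2,a+L)$ and, for $j=1,\dots,c-2$, $[a+jL/(2(c-1)),\,a+jL/(2(c-1))+L/2)$. Consequently the nodes at level $\ell$ are exactly the intervals $\left[m\frac{2^{n-\ell+1}}{c-1},(m+c-1)\frac{2^{n-\ell+1}}{c-1}\right)$ for $m=0,1,\dots,(c-1)2^\ell-(c-1)$, each of length $2^{n-\ell+1}$; leaves (level $n+1$) are single points. A query $Q=[x,x+s)$ is contained in $[a,b)$ iff $a\le x$ and $x+s\le b$. SRC-search: starting from the root, descend into any child whose interval still fully contains $Q$; stop at a node none of whose children contains $Q$ and return it (ties among such nodes, which all lie on the same level, broken by a fixed rule). $\mathrm{level}_{c\text{ -DAG}}(Q)$ denotes the level of the returned node. Logarithms are base 2.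
   Formalization: The query start x and the length s are taken in the rationals rather than the reals. -}

module Defs where

open import Data.Nat as ℕ using (ℕ; zero; suc; _∸_; _^_)
open import Data.Nat.Properties using (m^n≢0)
open import Data.Integer using (+_)
open import Data.Rational using (ℚ; _/_; _≤_; _<_; _+_; _-_; _*_)
open import Data.Empty using (⊥)
open import Data.Product using (_×_; _,_; Σ; ∃; ∃-syntax)
open import Relation.Binary.PropositionalEquality using (_≡_)

ℕ→ℚ : ℕ → ℚ
ℕ→ℚ k = (+ k) / 1

-- Parameters: n, α.  N = 2^(n+1), c = 2^α + 1, so c - 1 = 2^α.
bigN : ℕ → ℕ
bigN n = 2 ^ suc n

cc : ℕ → ℕ
cc α = suc (2 ^ α)

-- the "offset unit" 2^(n-ℓ+1)/(c-1) of level ℓ (used for 0 ≤ ℓ ≤ n+1)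
unit : (n α ℓ : ℕ) → ℚ
unit n α ℓ = _/_ (+ (2 ^ (suc n ∸ ℓ))) (2 ^ α) {{m^n≢0 2 α}}

-- A node of the c-DAG is identified by (level ℓ , index m); its canonical
-- interval is [ m·unit ℓ , (m + c - 1)·unit ℓ ).
Node : Set
Node = ℕ × ℕ

level : Node → ℕ
level (ℓ , _) = ℓ

lo : (n α : ℕ) → Node → ℚ
lo n α (ℓ , m) = ℕ→ℚ m * unit n α ℓ

hi : (n α : ℕ) → Node → ℚ
hi n α (ℓ , m) = ℕ→ℚ (m ℕ.+ 2 ^ α) * unit n α ℓ

Contains : (n α : ℕ) (x s : ℚ) → Node → Set
Contains n α x s v = (lo n α v ≤ x) × (x + s ≤ hi n α v)

-- w is a child of v: v = (ℓ, m) with ℓ ≤ n (not a leaf), and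
-- w = (ℓ+1, 2m + j) for some j ∈ {0, …, c-1}.  (j = 0 gives the left half,
-- j = c-1 the right half, and 1 ≤ j ≤ c-2 the shifted children.)
data ChildOf (n α : ℕ) : Node → Node → Set where
  child : ∀ {ℓ m} j → ℓ ℕ.≤ n → j ℕ.< cc α →
          ChildOf n α (suc ℓ , 2 ℕ.* m ℕ.+ j) (ℓ , m)

root : Node
root = (0 , 0)

-- nodes that SRC-search may visit (for some choice among admissible children)
data Visited (n α : ℕ) (x s : ℚ) : Node → Set where
  start : Visited n α x s root
  step  : ∀ {v w} → Visited n α x s v → ChildOf n α w v →
          Contains n α x s w → Visited n α x s w

-- nodes that SRC-search may return (for some tie-breaking rule):
-- visited nodes none of whose children contains Q
Returns : (n α : ℕ) (x s : ℚ) → Node → Set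
Returns n α x s v =
  Visited n α x s v × (∀ w → ChildOf n α w v → Contains n α x s w → ⊥)

ContainedAtLevel : (n α : ℕ) (x s : ℚ) (κ : ℕ) → Set
ContainedAtLevel n α x s κ =
  ∃[ m ] ((m ℕ.+ 2 ^ α ℕ.≤ 2 ^ α ℕ.* 2 ^ κ) × Contains n α x s (κ , m))

InContainmentUnion : (n α : ℕ) (x s : ℚ) (κ : ℕ) → Set
InContainmentUnion n α x s κ =
  ∃[ m ] ((m ℕ.+ 2 ^ α ℕ.≤ 2 ^ α ℕ.* 2 ^ κ) ×
          (ℕ→ℚ m * unit n α κ ≤ x) ×
          (x ≤ ℕ→ℚ (m ℕ.+ 2 ^ α) * unit n α κ - s))

InGapUnion : (n α : ℕ) (x s : ℚ) (κ : ℕ) → Set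
InGapUnion n α x s κ =
  ∃[ m ] ((m ℕ.+ cc α ℕ.≤ 2 ^ α ℕ.* 2 ^ κ) ×
          (ℕ→ℚ (m ℕ.+ 2 ^ α) * unit n α κ - s < x) ×
          (x < ℕ→ℚ (suc m) * unit n α κ))

module Submission where

-- Level-ℓ nodes are the windows [m u, (m + c - 1) u) of length len ℓ = 2^(n+1-ℓ) on the grid of
-- step u = len ℓ / (c - 1), and for ℓ ≤ n the children of a node are exactly the level-(ℓ+1)
-- windows inside it.  Scanning from the right the windows of one level that together cover Q,
-- either one of them contains Q or x lies in a gap ((g + c - 1) u - s, (g + 1) u) between two
-- consecutive containment intervals.  Such a gap rules out every window of its level, and it is
-- empty unless s > (c - 2) u, which is at least len (ℓ + 1) because c - 1 ≥ 2.  A window containing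
-- Q has length at least s, so the search never goes below level κ.  While ℓ + 2 ≤ κ we have
-- s ≤ len κ ≤ len (ℓ + 2), so level ℓ + 1 has no gap and the search goes on; at level κ - 1 it
-- stops exactly when no level-κ window contains Q, and then the scan of level κ puts x in a gap.

open import Defs
import Data.Nat
open import Data.Nat as ℕ using (ℕ; zero; suc; _∸_; _^_; z≤n; s≤s)
import Data.Nat.Properties as ℕ
open import Data.Nat.Tactic.RingSolver using (solve-∀)
open import Data.Integer as ℤ using (+_)
import Data.Integer.Properties as ℤ
import Data.Integer.Tactic.RingSolver as ℤ-Solver
open import Data.Rational
  using (ℚ; 0ℚ; 1ℚ; _/_; _≤_; _<_; _+_; _-_; -_; _*_; _≤?_; toℚᵘ; fromℚᵘ; NonNegative)
open import Data.Rational.Properties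
open import Data.Rational.Solver using (module +-*-Solver)
import Data.Rational.Unnormalised as ℚᵘ
import Data.Rational.Unnormalised.Properties as ℚᵘ
open import Data.Product using (_×_; _,_; ∃; ∃-syntax)
open import Data.Sum as Sum using (_⊎_; inj₁; inj₂; [_,_]′)
open import Data.Empty using (⊥-elim)
open import Function using (id; _∘_; case_of_)
open import Function.Bundles using (_⇔_; mk⇔)
open import Relation.Nullary using (¬_; Dec; yes; no; _×-dec_)
open import Relation.Binary.PropositionalEquality

<⇒≱ : ∀ {p q} → p < q → ¬ (q ≤ p)
<⇒≱ p<q q≤p = <-irrefl refl (<-≤-trans p<q q≤p)

p+q-q≡p : ∀ p q → p + q - q ≡ p
p+q-q≡p = solve 2 (λ p q → p :+ q :- q := p) refl
  where open +-*-Solver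

p-q+q≡p : ∀ p q → p - q + q ≡ p
p-q+q≡p = solve 2 (λ p q → p :- q :+ q := p) refl
  where open +-*-Solver

-p+[p+q]≡q : ∀ p q → - p + (p + q) ≡ q
-p+[p+q]≡q = solve 2 (λ p q → :- p :+ (p :+ q) := q) refl
  where open +-*-Solver

+-cancelˡ-≤ : ∀ r {p q} → r + p ≤ r + q → p ≤ q
+-cancelˡ-≤ r {p} {q} r+p≤r+q =
  subst₂ _≤_ (-p+[p+q]≡q r p) (-p+[p+q]≡q r q) (+-monoʳ-≤ (- r) r+p≤r+q)

p+q≤r⇒p≤r-q : ∀ {p q r} → p + q ≤ r → p ≤ r - q
p+q≤r⇒p≤r-q {p} {q} {r} p+q≤r = subst (_≤ r - q) (p+q-q≡p p q) (+-monoˡ-≤ (- q) p+q≤r)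

p≤r-q⇒p+q≤r : ∀ {p q r} → p ≤ r - q → p + q ≤ r
p≤r-q⇒p+q≤r {p} {q} {r} p≤r-q = subst (p + q ≤_) (p-q+q≡p r q) (+-monoˡ-≤ q p≤r-q)

r<p+q⇒r-q<p : ∀ {p q r} → r < p + q → r - q < p
r<p+q⇒r-q<p {p} {q} {r} r<p+q = subst (r - q <_) (p+q-q≡p p q) (+-monoˡ-< (- q) r<p+q)

r-q<p⇒r<p+q : ∀ {p q r} → r - q < p → r < p + q
r-q<p⇒r<p+q {p} {q} {r} r-q<p = subst (_< p + q) (p-q+q≡p r q) (+-monoˡ-< q r-q<p)

2^m≤2^n⇒m≤n : ∀ {m n} → 2 ^ m ℕ.≤ 2 ^ n → m ℕ.≤ n
2^m≤2^n⇒m≤n 2^m≤2^n = ℕ.≮⇒≥ (λ n<m → ℕ.<⇒≱ (ℕ.^-monoʳ-< 2 (s≤s (s≤s z≤n)) n<m) 2^m≤2^n)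

2^m<2^n⇒m<n : ∀ {m n} → 2 ^ m ℕ.< 2 ^ n → m ℕ.< n
2^m<2^n⇒m<n 2^m<2^n = ℕ.≰⇒> (λ n≤m → ℕ.<⇒≱ 2^m<2^n (ℕ.^-monoʳ-≤ 2 n≤m))


fromℚᵘ-homo-+ : ∀ p q → fromℚᵘ (p ℚᵘ.+ q) ≡ fromℚᵘ p + fromℚᵘ q
fromℚᵘ-homo-+ p q = toℚᵘ-injective (begin
  toℚᵘ (fromℚᵘ (p ℚᵘ.+ q))             ≈⟨ toℚᵘ-fromℚᵘ (p ℚᵘ.+ q) ⟩
  p ℚᵘ.+ q                             ≈⟨ ℚᵘ.+-cong (toℚᵘ-fromℚᵘ p) (toℚᵘ-fromℚᵘ q) ⟨
  toℚᵘ (fromℚᵘ p) ℚᵘ.+ toℚᵘ (fromℚᵘ q) ≈⟨ toℚᵘ-homo-+ (fromℚᵘ p) (fromℚᵘ q) ⟨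
  toℚᵘ (fromℚᵘ p + fromℚᵘ q)           ∎)
  where open ℚᵘ.≃-Reasoning

fromℚᵘ-homo-* : ∀ p q → fromℚᵘ (p ℚᵘ.* q) ≡ fromℚᵘ p * fromℚᵘ q
fromℚᵘ-homo-* p q = toℚᵘ-injective (begin
  toℚᵘ (fromℚᵘ (p ℚᵘ.* q))             ≈⟨ toℚᵘ-fromℚᵘ (p ℚᵘ.* q) ⟩
  p ℚᵘ.* q                             ≈⟨ ℚᵘ.*-cong (toℚᵘ-fromℚᵘ p) (toℚᵘ-fromℚᵘ q) ⟨
  toℚᵘ (fromℚᵘ p) ℚᵘ.* toℚᵘ (fromℚᵘ q) ≈⟨ toℚᵘ-homo-* (fromℚᵘ p) (fromℚᵘ q) ⟨
  toℚᵘ (fromℚᵘ p * fromℚᵘ q)           ∎)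
  where open ℚᵘ.≃-Reasoning

fromℚᵘ-mono-≤ : ∀ {p q} → p ℚᵘ.≤ q → fromℚᵘ p ≤ fromℚᵘ q
fromℚᵘ-mono-≤ {p} {q} p≤q = toℚᵘ-cancel-≤
  (ℚᵘ.≤-respˡ-≃ (ℚᵘ.≃-sym (toℚᵘ-fromℚᵘ p)) (ℚᵘ.≤-respʳ-≃ (ℚᵘ.≃-sym (toℚᵘ-fromℚᵘ q)) p≤q))

fromℚᵘ-cancel-≤ : ∀ {p q} → fromℚᵘ p ≤ fromℚᵘ q → p ℚᵘ.≤ q
fromℚᵘ-cancel-≤ {p} {q} p≤q =
  ℚᵘ.≤-respˡ-≃ (toℚᵘ-fromℚᵘ p) (ℚᵘ.≤-respʳ-≃ (toℚᵘ-fromℚᵘ q) (toℚᵘ-mono-≤ p≤q))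

-- For d = suc _, + a / d is by definition fromℚᵘ (+ a ℚᵘ./ d), and ℕ→ℚ is the case d = 1.
ℕ→ℚ-+ : ∀ a b → ℕ→ℚ (a ℕ.+ b) ≡ ℕ→ℚ a + ℕ→ℚ b
ℕ→ℚ-+ a b =
  trans (fromℚᵘ-cong {+ (a ℕ.+ b) ℚᵘ./ 1} {(+ a ℚᵘ./ 1) ℚᵘ.+ (+ b ℚᵘ./ 1)} (ℚᵘ.*≡* eq))
        (fromℚᵘ-homo-+ (+ a ℚᵘ./ 1) (+ b ℚᵘ./ 1))
  where
  ring : ∀ a b → (a ℤ.+ b) ℤ.* (+ 1 ℤ.* + 1) ≡ (a ℤ.* + 1 ℤ.+ b ℤ.* + 1) ℤ.* + 1
  ring = ℤ-Solver.solve-∀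
  eq : + (a ℕ.+ b) ℤ.* (+ 1 ℤ.* + 1) ≡ (+ a ℤ.* + 1 ℤ.+ + b ℤ.* + 1) ℤ.* + 1
  eq = trans (cong (ℤ._* (+ 1 ℤ.* + 1)) (ℤ.pos-+ a b)) (ring (+ a) (+ b))

ℕ→ℚ-*-/ : ∀ k a d .{{_ : ℕ.NonZero d}} → ℕ→ℚ k * (+ a / d) ≡ + (k ℕ.* a) / d
ℕ→ℚ-*-/ k a d@(suc _) = trans (sym (fromℚᵘ-homo-* (+ k ℚᵘ./ 1) (+ a ℚᵘ./ d)))
  (fromℚᵘ-cong {(+ k ℚᵘ./ 1) ℚᵘ.* (+ a ℚᵘ./ d)} {+ (k ℕ.* a) ℚᵘ./ d} (ℚᵘ.*≡* eq))
  where
  ring : ∀ k a d → k ℤ.* a ℤ.* d ≡ k ℤ.* a ℤ.* (+ 1 ℤ.* d)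
  ring = ℤ-Solver.solve-∀
  eq : + k ℤ.* + a ℤ.* + d ≡ + (k ℕ.* a) ℤ.* (+ 1 ℤ.* + d)
  eq = trans (ring (+ k) (+ a) (+ d)) (cong (ℤ._* (+ 1 ℤ.* + d)) (sym (ℤ.pos-* k a)))

[d*a]/d≡a : ∀ d a .{{_ : ℕ.NonZero d}} → + (d ℕ.* a) / d ≡ ℕ→ℚ a
[d*a]/d≡a d@(suc _) a = fromℚᵘ-cong {+ (d ℕ.* a) ℚᵘ./ d} {+ a ℚᵘ./ 1} (ℚᵘ.*≡* eq)
  where
  ring : ∀ d a → d ℤ.* a ℤ.* + 1 ≡ a ℤ.* d
  ring = ℤ-Solver.solve-∀
  eq : + (d ℕ.* a) ℤ.* + 1 ≡ + a ℤ.* + d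
  eq = trans (cong (ℤ._* + 1) (ℤ.pos-* d a)) (ring (+ d) (+ a))

ℕ→ℚ-mono-≤ : ∀ {a b} → a ℕ.≤ b → ℕ→ℚ a ≤ ℕ→ℚ b
ℕ→ℚ-mono-≤ {a} {b} a≤b = fromℚᵘ-mono-≤ {+ a ℚᵘ./ 1} {+ b ℚᵘ./ 1}
  (ℚᵘ.*≤* (ℤ.*-monoʳ-≤-nonNeg (+ 1) (ℤ.+≤+ a≤b)))

ℕ→ℚ-cancel-≤ : ∀ {a b} → ℕ→ℚ a ≤ ℕ→ℚ b → a ℕ.≤ b
ℕ→ℚ-cancel-≤ {a} {b} a≤b = ℤ.drop‿+≤+ (ℤ.*-cancelʳ-≤-pos (+ a) (+ b) (+ 1)
  (ℚᵘ.drop-*≤* (fromℚᵘ-cancel-≤ {+ a ℚᵘ./ 1} {+ b ℚᵘ./ 1} a≤b)))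

ℕ→ℚ-cancel-< : ∀ {a b} → ℕ→ℚ a < ℕ→ℚ b → a ℕ.< b
ℕ→ℚ-cancel-< a<b = ℕ.≰⇒> (<⇒≱ a<b ∘ ℕ→ℚ-mono-≤)

ℕ→ℚ-nonNeg : ∀ k → NonNegative (ℕ→ℚ k)
ℕ→ℚ-nonNeg k = normalize-nonNeg k 1

module Lengths (n : ℕ) where

  len : ℕ → ℕ
  len ℓ = 2 ^ (suc n ∸ ℓ)

  len-split : ∀ {ℓ} → ℓ ℕ.≤ suc n → 2 ^ ℓ ℕ.* len ℓ ≡ bigN n
  len-split {ℓ} ℓ≤1+n =
    trans (sym (ℕ.^-distribˡ-+-* 2 ℓ (suc n ∸ ℓ))) (cong (2 ^_) (ℕ.m+[n∸m]≡n ℓ≤1+n))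

  len-halves : ∀ {ℓ} → ℓ ℕ.≤ n → len ℓ ≡ 2 ℕ.* len (suc ℓ)
  len-halves ℓ≤n = cong (2 ^_) (ℕ.+-∸-assoc 1 ℓ≤n)

  len-antitone : ∀ {ℓ ℓ′} → ℓ ℕ.≤ ℓ′ → len ℓ′ ℕ.≤ len ℓ
  len-antitone ℓ≤ℓ′ = ℕ.^-monoʳ-≤ 2 (ℕ.∸-monoʳ-≤ (suc n) ℓ≤ℓ′)

  2^κs≤N⇒κ≤1+n : ∀ κ {s} → 1ℚ ≤ s → ℕ→ℚ (2 ^ κ) * s ≤ ℕ→ℚ (bigN n) → κ ℕ.≤ suc n
  2^κs≤N⇒κ≤1+n κ {s} 1≤s 2^κs≤N = 2^m≤2^n⇒m≤n (ℕ→ℚ-cancel-≤ {2 ^ κ} {bigN n} (begin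
    ℕ→ℚ (2 ^ κ)        ≡⟨ *-identityʳ (ℕ→ℚ (2 ^ κ)) ⟨
    ℕ→ℚ (2 ^ κ) * 1ℚ   ≤⟨ *-monoˡ-≤-nonNeg (ℕ→ℚ (2 ^ κ)) {{ℕ→ℚ-nonNeg (2 ^ κ)}} 1≤s ⟩
    ℕ→ℚ (2 ^ κ) * s    ≤⟨ 2^κs≤N ⟩
    ℕ→ℚ (bigN n)       ∎))
    where open ≤-Reasoning

  2^κs≤N⇒s≤len : ∀ κ {s} → κ ℕ.≤ suc n → ℕ→ℚ (2 ^ κ) * s ≤ ℕ→ℚ (bigN n) → s ≤ ℕ→ℚ (len κ)
  2^κs≤N⇒s≤len κ {s} κ≤1+n 2^κs≤N =
    *-cancelˡ-≤-pos (ℕ→ℚ (2 ^ κ)) {{normalize-pos (2 ^ κ) 1 {{_}} {{ℕ.m^n≢0 2 κ}}}} (begin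
      ℕ→ℚ (2 ^ κ) * s              ≤⟨ 2^κs≤N ⟩
      ℕ→ℚ (bigN n)                 ≡⟨ cong ℕ→ℚ (len-split κ≤1+n) ⟨
      ℕ→ℚ (2 ^ κ ℕ.* len κ)        ≡⟨ ℕ→ℚ-*-/ (2 ^ κ) (len κ) 1 ⟨
      ℕ→ℚ (2 ^ κ) * ℕ→ℚ (len κ)    ∎)
    where open ≤-Reasoning

  N<2^[1+κ]s⇒ℓ≤κ : ∀ κ {ℓ s} → ℕ→ℚ (bigN n) < ℕ→ℚ (2 ^ suc κ) * s →
                    ℓ ℕ.≤ suc n → s ≤ ℕ→ℚ (len ℓ) → ℓ ℕ.≤ κ
  N<2^[1+κ]s⇒ℓ≤κ κ {ℓ} {s} N<2^[1+κ]s ℓ≤1+n s≤len = ℕ.≤-pred (2^m<2^n⇒m<n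
    (ℕ.*-cancelʳ-< (len ℓ) (2 ^ ℓ) (2 ^ suc κ)
      (ℕ→ℚ-cancel-< {2 ^ ℓ ℕ.* len ℓ} {2 ^ suc κ ℕ.* len ℓ} (begin-strict
      ℕ→ℚ (2 ^ ℓ ℕ.* len ℓ)           ≡⟨ cong ℕ→ℚ (len-split ℓ≤1+n) ⟩
      ℕ→ℚ (bigN n)                    <⟨ N<2^[1+κ]s ⟩
      ℕ→ℚ (2 ^ suc κ) * s             ≤⟨ *-monoˡ-≤-nonNeg (ℕ→ℚ (2 ^ suc κ)) {{ℕ→ℚ-nonNeg (2 ^ suc κ)}} s≤len ⟩
      ℕ→ℚ (2 ^ suc κ) * ℕ→ℚ (len ℓ)   ≡⟨ ℕ→ℚ-*-/ (2 ^ suc κ) (len ℓ) 1 ⟩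
      ℕ→ℚ (2 ^ suc κ ℕ.* len ℓ)       ∎))))
    where open ≤-Reasoning

module Grid (n α : ℕ) where
  open Lengths n public

  instance
    2^α≢0 : ℕ.NonZero (2 ^ α)
    2^α≢0 = ℕ.m^n≢0 2 α

  -- lo and hi of the node (ℓ , m) are definitionally grid ℓ m and grid ℓ (m + 2 ^ α).
  grid : ℕ → ℕ → ℚ
  grid ℓ k = ℕ→ℚ k * unit n α ℓ

  grid-+ : ∀ ℓ a b → grid ℓ (a ℕ.+ b) ≡ grid ℓ a + grid ℓ b
  grid-+ ℓ a b =
    trans (cong (_* unit n α ℓ) (ℕ→ℚ-+ a b)) (*-distribʳ-+ (unit n α ℓ) (ℕ→ℚ a) (ℕ→ℚ b))

  grid-mono-≤ : ∀ ℓ {a b} → a ℕ.≤ b → grid ℓ a ≤ grid ℓ b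
  grid-mono-≤ ℓ a≤b =
    *-monoʳ-≤-nonNeg (unit n α ℓ) {{normalize-nonNeg (len ℓ) (2 ^ α)}} (ℕ→ℚ-mono-≤ a≤b)

  grid-refine : ∀ {ℓ} → ℓ ℕ.≤ n → ∀ k → grid ℓ k ≡ grid (suc ℓ) (2 ℕ.* k)
  grid-refine {ℓ} ℓ≤n k = begin
    ℕ→ℚ k * (+ len ℓ / 2 ^ α)                   ≡⟨ ℕ→ℚ-*-/ k (len ℓ) (2 ^ α) ⟩
    + (k ℕ.* len ℓ) / 2 ^ α                     ≡⟨ cong (λ i → + i / 2 ^ α) k*len≡ ⟩
    + (2 ℕ.* k ℕ.* len (suc ℓ)) / 2 ^ α         ≡⟨ ℕ→ℚ-*-/ (2 ℕ.* k) (len (suc ℓ)) (2 ^ α) ⟨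
    ℕ→ℚ (2 ℕ.* k) * (+ len (suc ℓ) / 2 ^ α)     ∎
    where
    open ≡-Reasoning
    ring : ∀ k l → k ℕ.* (2 ℕ.* l) ≡ 2 ℕ.* k ℕ.* l
    ring = solve-∀
    k*len≡ : k ℕ.* len ℓ ≡ 2 ℕ.* k ℕ.* len (suc ℓ)
    k*len≡ = trans (cong (k ℕ.*_) (len-halves ℓ≤n)) (ring k (len (suc ℓ)))

  grid-span : ∀ ℓ → grid ℓ (2 ^ α) ≡ ℕ→ℚ (len ℓ)
  grid-span ℓ = trans (ℕ→ℚ-*-/ (2 ^ α) (len ℓ) (2 ^ α)) ([d*a]/d≡a (2 ^ α) (len ℓ))

  grid-top : ∀ {ℓ} → ℓ ℕ.≤ suc n → grid ℓ (2 ^ α ℕ.* 2 ^ ℓ) ≡ ℕ→ℚ (bigN n)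
  grid-top {ℓ} ℓ≤1+n = begin
    ℕ→ℚ (2 ^ α ℕ.* 2 ^ ℓ) * (+ len ℓ / 2 ^ α)   ≡⟨ ℕ→ℚ-*-/ (2 ^ α ℕ.* 2 ^ ℓ) (len ℓ) (2 ^ α) ⟩
    + (2 ^ α ℕ.* 2 ^ ℓ ℕ.* len ℓ) / 2 ^ α       ≡⟨ cong (λ i → + i / 2 ^ α) (ℕ.*-assoc (2 ^ α) _ _) ⟩
    + (2 ^ α ℕ.* (2 ^ ℓ ℕ.* len ℓ)) / 2 ^ α     ≡⟨ [d*a]/d≡a (2 ^ α) (2 ^ ℓ ℕ.* len ℓ) ⟩
    ℕ→ℚ (2 ^ ℓ ℕ.* len ℓ)                       ≡⟨ cong ℕ→ℚ (len-split ℓ≤1+n) ⟩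
    ℕ→ℚ (bigN n)                                ∎
    where open ≡-Reasoning

  between⇒ChildOf : ∀ {ℓ m m′} → ℓ ℕ.≤ n → 2 ℕ.* m ℕ.≤ m′ → m′ ℕ.≤ 2 ^ α ℕ.+ 2 ℕ.* m →
                    ChildOf n α (suc ℓ , m′) (ℓ , m)
  between⇒ChildOf {ℓ} {m} {m′} ℓ≤n 2m≤m′ m′≤P+2m =
    subst (λ i → ChildOf n α (suc ℓ , i) (ℓ , m)) (ℕ.m+[n∸m]≡n 2m≤m′)
      (child (m′ ∸ 2 ℕ.* m) ℓ≤n (s≤s (ℕ.m≤n+o⇒m∸n≤o m′ (2 ℕ.* m) m′≤2m+P)))
    where
    m′≤2m+P : m′ ℕ.≤ 2 ℕ.* m ℕ.+ 2 ^ α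
    m′≤2m+P = ℕ.≤-trans m′≤P+2m (ℕ.≤-reflexive (ℕ.+-comm (2 ^ α) (2 ℕ.* m)))

  child-index-bound : ∀ {ℓ m j} → j ℕ.≤ 2 ^ α → m ℕ.+ 2 ^ α ℕ.≤ 2 ^ α ℕ.* 2 ^ ℓ →
                     2 ℕ.* m ℕ.+ j ℕ.+ 2 ^ α ℕ.≤ 2 ^ α ℕ.* 2 ^ suc ℓ
  child-index-bound {ℓ} {m} {j} j≤P bound = begin
    2 ℕ.* m ℕ.+ j ℕ.+ 2 ^ α            ≤⟨ ℕ.+-monoˡ-≤ (2 ^ α) (ℕ.+-monoʳ-≤ (2 ℕ.* m) j≤P) ⟩
    2 ℕ.* m ℕ.+ 2 ^ α ℕ.+ 2 ^ α        ≡⟨ ring₁ m (2 ^ α) ⟩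
    2 ℕ.* (m ℕ.+ 2 ^ α)                ≤⟨ ℕ.*-monoʳ-≤ 2 bound ⟩
    2 ℕ.* (2 ^ α ℕ.* 2 ^ ℓ)            ≡⟨ ring₂ (2 ^ α) (2 ^ ℓ) ⟩
    2 ^ α ℕ.* (2 ℕ.* 2 ^ ℓ)            ∎
    where
    open ℕ.≤-Reasoning
    ring₁ : ∀ m P → 2 ℕ.* m ℕ.+ P ℕ.+ P ≡ 2 ℕ.* (m ℕ.+ P)
    ring₁ = solve-∀
    ring₂ : ∀ P e → 2 ℕ.* (P ℕ.* e) ≡ P ℕ.* (2 ℕ.* e)
    ring₂ = solve-∀

module Search (n α : ℕ) (x s : ℚ) where
  open Grid n α

  Contains? : ∀ v → Dec (Contains n α x s v)
  Contains? (ℓ , m) = (grid ℓ m ≤? x) ×-dec (x + s ≤? grid ℓ (m ℕ.+ 2 ^ α))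

  HasContainingChild : Node → Set
  HasContainingChild v = ∃[ w ] ChildOf n α w v × Contains n α x s w

  InGap : ℕ → ℕ → Set
  InGap ℓ g = grid ℓ (g ℕ.+ 2 ^ α) - s < x × x < grid ℓ (suc g)

  no-child : ∀ {v} → Returns n α x s v → ¬ HasContainingChild v
  no-child (_ , childless) (w , w-child , c) = childless w w-child c

  Contains⇒s≤len : ∀ {ℓ m} → Contains n α x s (ℓ , m) → s ≤ ℕ→ℚ (len ℓ)
  Contains⇒s≤len {ℓ} {m} (lo≤x , x+s≤hi) = +-cancelˡ-≤ (grid ℓ m) (begin
    grid ℓ m + s                ≤⟨ +-monoˡ-≤ s lo≤x ⟩
    x + s                       ≤⟨ x+s≤hi ⟩
    grid ℓ (m ℕ.+ 2 ^ α)        ≡⟨ grid-+ ℓ m (2 ^ α) ⟩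
    grid ℓ m + grid ℓ (2 ^ α)   ≡⟨ cong (λ q → grid ℓ m + q) (grid-span ℓ) ⟩
    grid ℓ m + ℕ→ℚ (len ℓ)      ∎)
    where open ≤-Reasoning

  InGap⇒¬Contains : ∀ {ℓ g m} → InGap ℓ g → ¬ Contains n α x s (ℓ , m)
  InGap⇒¬Contains {ℓ} {g} {m} (hi-s<x , x<lo) (lo≤x , x+s≤hi) = [
    (λ m≤g → <⇒≱ (r-q<p⇒r<p+q hi-s<x) (≤-trans x+s≤hi (grid-mono-≤ ℓ (ℕ.+-monoˡ-≤ (2 ^ α) m≤g)))) ,
    (λ g<m → <⇒≱ x<lo (≤-trans (grid-mono-≤ ℓ g<m) lo≤x)) ]′ (ℕ.≤-<-connex m g)

  short⇒¬InGap : 2 ℕ.≤ 2 ^ α → ∀ {ℓ} → ℓ ℕ.≤ n → s ≤ ℕ→ℚ (len (suc ℓ)) → ∀ g → ¬ InGap ℓ g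
  short⇒¬InGap 2≤P {ℓ} ℓ≤n s≤len g (hi-s<x , x<lo) = <-irrefl refl (begin-strict
    grid ℓ (g ℕ.+ 2 ^ α)                               <⟨ r-q<p⇒r<p+q hi-s<x ⟩
    x + s                                              <⟨ +-monoˡ-< s x<lo ⟩
    grid ℓ (suc g) + s                                 ≤⟨ +-monoʳ-≤ (grid ℓ (suc g)) s≤len ⟩
    grid ℓ (suc g) + ℕ→ℚ (len (suc ℓ))                 ≡⟨ cong₂ _+_ (grid-refine ℓ≤n (suc g))
                                                                        (sym (grid-span (suc ℓ))) ⟩
    grid (suc ℓ) (2 ℕ.* suc g) + grid (suc ℓ) (2 ^ α)  ≡⟨ grid-+ (suc ℓ) (2 ℕ.* suc g) (2 ^ α) ⟨
    grid (suc ℓ) (2 ℕ.* suc g ℕ.+ 2 ^ α)               ≤⟨ grid-mono-≤ (suc ℓ) 2[1+g]+P≤2[g+P] ⟩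
    grid (suc ℓ) (2 ℕ.* (g ℕ.+ 2 ^ α))                 ≡⟨ grid-refine ℓ≤n (g ℕ.+ 2 ^ α) ⟨
    grid ℓ (g ℕ.+ 2 ^ α)                               ∎)
    where
    open ≤-Reasoning
    ring₁ : ∀ g P → 2 ℕ.* suc g ℕ.+ P ≡ 2 ℕ.* g ℕ.+ P ℕ.+ 2
    ring₁ = solve-∀
    ring₂ : ∀ g P → 2 ℕ.* g ℕ.+ P ℕ.+ P ≡ 2 ℕ.* (g ℕ.+ P)
    ring₂ = solve-∀
    2[1+g]+P≤2[g+P] : 2 ℕ.* suc g ℕ.+ 2 ^ α ℕ.≤ 2 ℕ.* (g ℕ.+ 2 ^ α)
    2[1+g]+P≤2[g+P] = subst₂ ℕ._≤_ (sym (ring₁ g (2 ^ α))) (ring₂ g (2 ^ α))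
                                     (ℕ.+-monoʳ-≤ (2 ℕ.* g ℕ.+ 2 ^ α) 2≤P)

  -- The rightmost window with left end at most x either contains Q or leaves x in the gap behind it.
  contained-or-gap : ∀ ℓ {a} k → grid ℓ a ≤ x → x + s ≤ grid ℓ (k ℕ.+ a ℕ.+ 2 ^ α) →
                     (∃[ m ] a ℕ.≤ m × m ℕ.≤ k ℕ.+ a × Contains n α x s (ℓ , m)) ⊎
                     (∃[ g ] g ℕ.< k ℕ.+ a × InGap ℓ g)
  contained-or-gap ℓ {a} zero lo≤x x+s≤hi = inj₁ (a , ℕ.≤-refl , ℕ.≤-refl , lo≤x , x+s≤hi)
  contained-or-gap ℓ {a} (suc k) lo≤x x+s≤hi = case x + s ≤? grid ℓ (k ℕ.+ a ℕ.+ 2 ^ α) of λ where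
    (yes x+s≤hi′) → Sum.map (λ (m , a≤m , m≤k+a , c) → m , a≤m , ℕ.m≤n⇒m≤1+n m≤k+a , c)
                            (λ (g , g<k+a , gap) → g , ℕ.m≤n⇒m≤1+n g<k+a , gap)
                            (contained-or-gap ℓ k lo≤x x+s≤hi′)
    (no x+s≰hi′) → case grid ℓ (suc k ℕ.+ a) ≤? x of λ where
      (yes lo′≤x) → inj₁ (suc k ℕ.+ a , ℕ.m≤n+m a (suc k) , ℕ.≤-refl , lo′≤x , x+s≤hi)
      (no lo′≰x)  → inj₂ (k ℕ.+ a , ℕ.≤-refl , r<p+q⇒r-q<p (≰⇒> x+s≰hi′) , ≰⇒> lo′≰x)

  child-or-gap : ∀ {ℓ m} → ℓ ℕ.≤ n → Contains n α x s (ℓ , m) →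
                 HasContainingChild (ℓ , m) ⊎ ∃ (InGap (suc ℓ))
  child-or-gap {ℓ} {m} ℓ≤n (lo≤x , x+s≤hi) =
    Sum.map (λ (m′ , 2m≤m′ , m′≤P+2m , c) → (suc ℓ , m′) , between⇒ChildOf ℓ≤n 2m≤m′ m′≤P+2m , c)
            (λ (g , _ , gap) → g , gap)
            (contained-or-gap (suc ℓ) (2 ^ α) (subst (_≤ x) (grid-refine ℓ≤n m) lo≤x)
                                              (subst (x + s ≤_) hi≡ x+s≤hi))
    where
    ring : ∀ m P → 2 ℕ.* (m ℕ.+ P) ≡ P ℕ.+ 2 ℕ.* m ℕ.+ P
    ring = solve-∀
    hi≡ : grid ℓ (m ℕ.+ 2 ^ α) ≡ grid (suc ℓ) (2 ^ α ℕ.+ 2 ℕ.* m ℕ.+ 2 ^ α)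
    hi≡ = trans (grid-refine ℓ≤n (m ℕ.+ 2 ^ α)) (cong (grid (suc ℓ)) (ring m (2 ^ α)))

  short⇒HasContainingChild : 2 ℕ.≤ 2 ^ α → ∀ {ℓ m} → suc ℓ ℕ.≤ n → s ≤ ℕ→ℚ (len (2 ℕ.+ ℓ)) →
                              Contains n α x s (ℓ , m) → HasContainingChild (ℓ , m)
  short⇒HasContainingChild 2≤P 1+ℓ≤n s≤len c =
    [ id , (λ (g , gap) → ⊥-elim (short⇒¬InGap 2≤P 1+ℓ≤n s≤len g gap)) ]′
    (child-or-gap (ℕ.<⇒≤ 1+ℓ≤n) c)

  next-level⇒HasContainingChild : ∀ {ℓ m} → ℓ ℕ.≤ n → ContainedAtLevel n α x s (suc ℓ) →
                                   Contains n α x s (ℓ , m) → HasContainingChild (ℓ , m)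
  next-level⇒HasContainingChild {ℓ} ℓ≤n (m′ , _ , c′) c =
    [ id , (λ (g , gap) → ⊥-elim (InGap⇒¬Contains {suc ℓ} {g} {m′} gap c′)) ]′ (child-or-gap ℓ≤n c)

  Visited⇒level≤ : ∀ {ℓ m} → Visited n α x s (ℓ , m) → ℓ ℕ.≤ suc n
  Visited⇒level≤ start                     = z≤n
  Visited⇒level≤ (step _ (child _ ℓ≤n _) _) = s≤s ℓ≤n

  Visited⇒index-bound : ∀ {ℓ m} → Visited n α x s (ℓ , m) → m ℕ.+ 2 ^ α ℕ.≤ 2 ^ α ℕ.* 2 ^ ℓ
  Visited⇒index-bound start                         = ℕ.≤-reflexive (sym (ℕ.*-identityʳ (2 ^ α)))
  Visited⇒index-bound (step {ℓ , m} V (child j _ j<1+P) _) =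
    child-index-bound {ℓ} {m} {j} (ℕ.≤-pred j<1+P) (Visited⇒index-bound V)

  ContainedAtLevel⇒InContainmentUnion : ∀ {κ} → ContainedAtLevel n α x s κ →
                                        InContainmentUnion n α x s κ
  ContainedAtLevel⇒InContainmentUnion (m , bound , lo≤x , x+s≤hi) =
    m , bound , lo≤x , p+q≤r⇒p≤r-q x+s≤hi

  InContainmentUnion⇒ContainedAtLevel : ∀ {κ} → InContainmentUnion n α x s κ →
                                        ContainedAtLevel n α x s κ
  InContainmentUnion⇒ContainedAtLevel (m , bound , lo≤x , x≤hi-s) =
    m , bound , lo≤x , p≤r-q⇒p+q≤r x≤hi-s

  InGapUnion⇒¬ContainedAtLevel : ∀ {κ} → InGapUnion n α x s κ → ¬ ContainedAtLevel n α x s κ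
  InGapUnion⇒¬ContainedAtLevel {κ} (g , _ , gap) (m , _ , c) = InGap⇒¬Contains {κ} {g} {m} gap c

  module QueryInDomain (0≤x : 0ℚ ≤ x) (x+s≤N : x + s ≤ ℕ→ℚ (bigN n)) where

    grid₀≤x : ∀ ℓ → grid ℓ 0 ≤ x
    grid₀≤x ℓ = subst (_≤ x) (sym (*-zeroˡ (unit n α ℓ))) 0≤x

    Visited⇒Contains : ∀ {v} → Visited n α x s v → Contains n α x s v
    Visited⇒Contains start      = grid₀≤x 0 , subst (x + s ≤_) (sym (grid-span 0)) x+s≤N
    Visited⇒Contains (step _ _ c) = c

    Returns⇒Contains : ∀ {v} → Returns n α x s v → Contains n α x s v
    Returns⇒Contains (V , _) = Visited⇒Contains V

    Returns⇒ContainedAtLevel : ∀ {ℓ m} → Returns n α x s (ℓ , m) → ContainedAtLevel n α x s ℓ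
    Returns⇒ContainedAtLevel {m = m} (V , _) = m , Visited⇒index-bound V , Visited⇒Contains V

    Returns-exists : ∃[ v ] Returns n α x s v
    Returns-exists = descend (suc n) (ℕ.+-identityʳ (suc n)) start
      where
      descend : ∀ d {ℓ m} → d ℕ.+ ℓ ≡ suc n → Visited n α x s (ℓ , m) → ∃[ v ] Returns n α x s v
      descend zero refl V = _ , V , λ { _ (child _ 1+n≤n _) _ → ℕ.1+n≰n 1+n≤n }
      descend (suc d) {ℓ} {m} 1+d+ℓ≡1+n V =
        case ℕ.anyUpTo? (λ j → Contains? (suc ℓ , 2 ℕ.* m ℕ.+ j)) (suc (2 ^ α)) of λ where
          (yes (j , j<1+P , c)) →
            descend d (trans (ℕ.+-suc d ℓ) 1+d+ℓ≡1+n) (step V (child j ℓ≤n j<1+P) c)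
          (no none) → (ℓ , m) , V , λ { _ (child j _ j<1+P) c → none (j , j<1+P , c) }
        where
        ℓ≤n : ℓ ℕ.≤ n
        ℓ≤n = ℕ.m+n≤o⇒n≤o d (ℕ.≤-reflexive (ℕ.suc-injective 1+d+ℓ≡1+n))

    ¬ContainedAtLevel⇒InGapUnion : ∀ {κ} → κ ℕ.≤ suc n → ¬ ContainedAtLevel n α x s κ →
                                   InGapUnion n α x s κ
    ¬ContainedAtLevel⇒InGapUnion {κ} κ≤1+n ¬C =
      [ (λ (m , _ , m≤top , c) → ⊥-elim (¬C (m , index-bound m≤top , c)))
      , (λ (g , g<top , gap) → g , subst (ℕ._≤ T) (sym (ℕ.+-suc g (2 ^ α))) (index-bound g<top) , gap) ]′
      (contained-or-gap κ top (grid₀≤x κ) (subst (x + s ≤_) hi≡N x+s≤N))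
      where
      T = 2 ^ α ℕ.* 2 ^ κ
      top = T ∸ 2 ^ α
      top+0+P≡T : top ℕ.+ 0 ℕ.+ 2 ^ α ≡ T
      top+0+P≡T = trans (cong (ℕ._+ 2 ^ α) (ℕ.+-identityʳ top))
                        (ℕ.m∸n+n≡m (ℕ.m≤m*n (2 ^ α) (2 ^ κ) {{ℕ.m^n≢0 2 κ}}))
      index-bound : ∀ {i} → i ℕ.≤ top ℕ.+ 0 → i ℕ.+ 2 ^ α ℕ.≤ T
      index-bound i≤top = ℕ.≤-trans (ℕ.+-monoˡ-≤ (2 ^ α) i≤top) (ℕ.≤-reflexive top+0+P≡T)
      hi≡N : ℕ→ℚ (bigN n) ≡ grid κ (top ℕ.+ 0 ℕ.+ 2 ^ α)
      hi≡N = trans (sym (grid-top κ≤1+n)) (cong (grid κ) (sym top+0+P≡T))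

    module ReturnedLevel (2≤P : 2 ℕ.≤ 2 ^ α) (κ : ℕ) (1≤s : 1ℚ ≤ s)
                         (2^κs≤N : ℕ→ℚ (2 ^ κ) * s ≤ ℕ→ℚ (bigN n))
                         (N<2^[1+κ]s : ℕ→ℚ (bigN n) < ℕ→ℚ (2 ^ suc κ) * s) where

      κ≤1+n : κ ℕ.≤ suc n
      κ≤1+n = 2^κs≤N⇒κ≤1+n κ 1≤s 2^κs≤N

      level-cases : ∀ {ℓ m} → Returns n α x s (ℓ , m) → ℓ ≡ κ ⊎ suc ℓ ≡ κ
      level-cases {ℓ} {m} r@(V , _) =
        [ [ ⊥-elim ∘ no-child r ∘ descends , inj₂ ]′ ∘ ℕ.m≤n⇒m<n∨m≡n , inj₁ ]′ (ℕ.m≤n⇒m<n∨m≡n ℓ≤κ)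
        where
        ℓ≤κ : ℓ ℕ.≤ κ
        ℓ≤κ = N<2^[1+κ]s⇒ℓ≤κ κ N<2^[1+κ]s (Visited⇒level≤ V)
                (Contains⇒s≤len {ℓ} {m} (Visited⇒Contains V))
        descends : 2 ℕ.+ ℓ ℕ.≤ κ → HasContainingChild (ℓ , m)
        descends 2+ℓ≤κ = short⇒HasContainingChild 2≤P (ℕ.≤-pred (ℕ.≤-trans 2+ℓ≤κ κ≤1+n))
          (≤-trans (2^κs≤N⇒s≤len κ κ≤1+n 2^κs≤N) (ℕ→ℚ-mono-≤ (len-antitone 2+ℓ≤κ))) (Returns⇒Contains r)

      level-κ : ∀ {ℓ m} → Returns n α x s (ℓ , m) → ContainedAtLevel n α x s κ → ℓ ≡ κ
      level-κ {ℓ} {m} r C = [ id , ⊥-elim ∘ no-child r ∘ descends ]′ (level-cases r)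
        where
        descends : suc ℓ ≡ κ → HasContainingChild (ℓ , m)
        descends 1+ℓ≡κ = next-level⇒HasContainingChild
          (ℕ.≤-pred (ℕ.≤-trans (ℕ.≤-reflexive 1+ℓ≡κ) κ≤1+n))
          (subst (ContainedAtLevel n α x s) (sym 1+ℓ≡κ) C) (Returns⇒Contains r)

      level-κ-1 : ∀ {ℓ m} → Returns n α x s (ℓ , m) → ¬ ContainedAtLevel n α x s κ → suc ℓ ≡ κ
      level-κ-1 r ¬C =
        [ (λ ℓ≡κ → ⊥-elim (¬C (subst (ContainedAtLevel n α x s) ℓ≡κ (Returns⇒ContainedAtLevel r))))
        , id ]′ (level-cases r)

lemma1 : (n α : ℕ) → 1 Data.Nat.≤ α →
         (x s : ℚ) →
         0ℚ ≤ x → x + s ≤ ℕ→ℚ (bigN n) →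
         1ℚ ≤ s → s ≤ ℕ→ℚ (bigN n) →
         (κ : ℕ) →
         ℕ→ℚ (2 ^ κ) * s ≤ ℕ→ℚ (bigN n) →
         ℕ→ℚ (bigN n) < ℕ→ℚ (2 ^ suc κ) * s →
         (∃[ v ] Returns n α x s v) ×
         (∀ v → Returns n α x s v →
            (ContainedAtLevel n α x s κ → level v ≡ κ) ×
            (¬ ContainedAtLevel n α x s κ →
               (suc (level v) ≡ κ) × Contains n α x s v) ×
            ((level v ≡ κ) ⊎ (suc (level v) ≡ κ)) ×
            ((level v ≡ κ) ⇔ InContainmentUnion n α x s κ) ×
            ((suc (level v) ≡ κ) ⇔ InGapUnion n α x s κ))
-- The hypothesis s ≤ N is implied by 0 ≤ x and x + s ≤ N.
lemma1 n α 1≤α x s 0≤x x+s≤N 1≤s _ κ 2^κs≤N N<2^[1+κ]s =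
  Returns-exists , λ where
    (ℓ , m) r →
        level-κ r
      , (λ ¬C → level-κ-1 r ¬C , Returns⇒Contains r)
      , level-cases r
      , mk⇔ (λ ℓ≡κ → ContainedAtLevel⇒InContainmentUnion {κ}
                       (subst (ContainedAtLevel n α x s) ℓ≡κ (Returns⇒ContainedAtLevel r)))
            (level-κ r ∘ InContainmentUnion⇒ContainedAtLevel {κ})
      , mk⇔ (λ 1+ℓ≡κ → ¬ContainedAtLevel⇒InGapUnion κ≤1+n
                         (λ C → ℕ.1+n≢n (trans 1+ℓ≡κ (sym (level-κ r C)))))
            (level-κ-1 r ∘ InGapUnion⇒¬ContainedAtLevel {κ})
  where
  open Search n α x s
  open QueryInDomain 0≤x x+s≤N
  open ReturnedLevel (ℕ.^-monoʳ-≤ 2 1≤α) κ 1≤s 2^κs≤N N<2^[1+κ]s
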